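{- Let $L$ be a residuated lattice and $n\geq 1$ an integer. Every $n$-fold positive implicative filter of $L$ is an $n$-fold implicative filter of $L$.
   Context: A residuated lattice is an algebra $(L,\wedge,\vee,\otimes,\rightarrow,0,1)$ such that $(L,\wedge,\vee,0,1)$ is a bounded lattice, $(L,\otimes,1)$ is a commutative monoid, and $x\otimes y\leq z$ iff $x\leq y\rightarrow z$. For $x\in L$, $x^n=x\otimes\cdots\otimes x$ ($n$ factors). A subset $F\subseteq L$ is an $n$-fold positive implicative filter if $1\in F$ and for all $x,y,z\in L$: if $x\rightarrow((y^n\rightarrow z)\rightarrow y)\in F$ and $x\in F$, then $y\in F$. A subset $F\subseteq L$ is an $n$-fold implicative filter if $1\in F$ and for all $x,y,z\in L$: if $x^n\rightarrow(y\rightarrow z)\in F$ and $x^n\rightarrow y\in F$, then $x^n\rightarrow z\in F$. -}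

module Defs where

open import Level using (Level; suc; _⊔_)
open import Data.Nat using (ℕ; zero) renaming (suc to sucℕ)
open import Relation.Binary.PropositionalEquality using (_≡_)
open import Relation.Binary.Structures using (IsPartialOrder)
open import Relation.Binary.Lattice.Structures using (IsBoundedLattice)
open import Algebra.Structures using (IsCommutativeMonoid)
open import Data.Product using (_×_)

record ResiduatedLattice (c ℓ : Level) : Set (suc (c ⊔ ℓ)) where
  infix  4 _≤_
  infixr 6 _∧_ _∨_
  infixr 7 _⊗_
  infixr 5 _⇒_
  field
    Carrier : Set c
    _≤_     : Carrier → Carrier → Set ℓ
    _∧_     : Carrier → Carrier → Carrier
    _∨_     : Carrier → Carrier → Carrier
    _⊗_     : Carrier → Carrier → Carrier
    _⇒_     : Carrier → Carrier → Carrier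
    𝟘       : Carrier
    𝟙       : Carrier
    isBoundedLattice    : IsBoundedLattice _≡_ _≤_ _∨_ _∧_ 𝟙 𝟘
    isCommutativeMonoid : IsCommutativeMonoid _≡_ _⊗_ 𝟙
    residuation₁ : ∀ x y z → x ⊗ y ≤ z → x ≤ y ⇒ z
    residuation₂ : ∀ x y z → x ≤ y ⇒ z → x ⊗ y ≤ z

module _ {c ℓ : Level} (L : ResiduatedLattice c ℓ) where
  open ResiduatedLattice L

  pow : Carrier → ℕ → Carrier
  pow x zero       = 𝟙
  pow x (sucℕ zero) = x
  pow x (sucℕ (sucℕ n)) = x ⊗ pow x (sucℕ n)

  IsNFoldPosImplFilter : ℕ → (Carrier → Set ℓ) → Set (c ⊔ ℓ)
  IsNFoldPosImplFilter n F =
    F 𝟙 × (∀ x y z → F (x ⇒ ((pow y n ⇒ z) ⇒ y)) → F x → F y)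

  IsNFoldImplFilter : ℕ → (Carrier → Set ℓ) → Set (c ⊔ ℓ)
  IsNFoldImplFilter n F =
    F 𝟙 × (∀ x y z → F (pow x n ⇒ (y ⇒ z)) → F (pow x n ⇒ y) → F (pow x n ⇒ z))

-- Every n-fold positive implicative filter F is a filter, and for every x the element
-- u = x ∨ ¬ xⁿ lies in F, because ¬ uⁿ ≤ ¬ xⁿ ≤ u. Multiplying by u sends xⁿ ⊗ t into
-- xⁿ ⊗ (x ⊗ t) (the ¬ xⁿ part kills xⁿ), so chaining n such steps inside F gives
-- xⁿ ⇒ xⁿ ⊗ xⁿ ∈ F. With this, the hypotheses xⁿ ⇒ (y ⇒ z), xⁿ ⇒ y ∈ F yield
-- xⁿ ⊗ xⁿ ⇒ z ∈ F and hence xⁿ ⇒ z ∈ F.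
module Submission where

open import Defs
open import Level using (Level; _⊔_)
open import Data.Nat using (ℕ; _≥_; zero; suc)
open import Data.Product using (_,_; proj₁; proj₂)
open import Relation.Binary.PropositionalEquality using (_≡_; refl; sym; cong; subst; subst₂)
open import Algebra.Structures using (IsCommutativeMonoid)
open import Relation.Binary.Lattice.Structures using (IsBoundedLattice)
open import Relation.Binary.Bundles using (Poset)
import Relation.Binary.Reasoning.PartialOrder as ≤-Reasoning

module ResiduatedLatticeProperties {c ℓ : Level} (L : ResiduatedLattice c ℓ) where
  open ResiduatedLattice L
  open IsBoundedLattice isBoundedLattice public
    using (maximum; minimum; x≤x∨y; y≤x∨y; ∨-least)
    renaming (refl to ≤-refl; trans to ≤-trans; antisym to ≤-antisym; reflexive to ≤-reflexive)
  open IsCommutativeMonoid isCommutativeMonoid public using (assoc; comm; identityˡ; identityʳ)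
  open IsBoundedLattice isBoundedLattice using (isPartialOrder)

  poset : Poset c c ℓ
  poset = record { isPartialOrder = isPartialOrder }

  open ≤-Reasoning poset

  ¬_ : Carrier → Carrier
  ¬ a = a ⇒ 𝟘

  ⇒-eval : ∀ a b → (a ⇒ b) ⊗ a ≤ b
  ⇒-eval a b = residuation₂ _ _ _ ≤-refl

  ⊗-monoˡ-≤ : ∀ {a b} t → a ≤ b → a ⊗ t ≤ b ⊗ t
  ⊗-monoˡ-≤ t a≤b = residuation₂ _ _ _ (≤-trans a≤b (residuation₁ _ _ _ ≤-refl))

  ⊗-monoʳ-≤ : ∀ {a b} t → a ≤ b → t ⊗ a ≤ t ⊗ b
  ⊗-monoʳ-≤ {a} {b} t a≤b = subst₂ _≤_ (comm a t) (comm b t) (⊗-monoˡ-≤ t a≤b)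

  ⊗-mono-≤ : ∀ {a b d e} → a ≤ b → d ≤ e → a ⊗ d ≤ b ⊗ e
  ⊗-mono-≤ a≤b d≤e = ≤-trans (⊗-monoˡ-≤ _ a≤b) (⊗-monoʳ-≤ _ d≤e)

  x⊗y≤x : ∀ a t → a ⊗ t ≤ a
  x⊗y≤x a t = subst (a ⊗ t ≤_) (identityʳ a) (⊗-monoʳ-≤ a (maximum t))

  ≤⇒⇒≡𝟙 : ∀ {a b} → a ≤ b → a ⇒ b ≡ 𝟙
  ≤⇒⇒≡𝟙 a≤b = ≤-antisym (maximum _) (residuation₁ _ _ _ (subst (_≤ _) (sym (identityˡ _)) a≤b))

  ¬-antitone : ∀ {a b} → a ≤ b → ¬ b ≤ ¬ a
  ¬-antitone {a} {b} a≤b = residuation₁ _ _ _ (≤-trans (⊗-monoʳ-≤ _ a≤b) (⇒-eval b 𝟘))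

  𝟘-zeroˡ : ∀ a → 𝟘 ⊗ a ≤ 𝟘
  𝟘-zeroˡ a = residuation₂ _ _ _ (minimum _)

  pow-mono-≤ : ∀ {a b} m → a ≤ b → pow L a m ≤ pow L b m
  pow-mono-≤ zero          a≤b = ≤-refl
  pow-mono-≤ (suc zero)    a≤b = a≤b
  pow-mono-≤ (suc (suc m)) a≤b = ⊗-mono-≤ a≤b (pow-mono-≤ (suc m) a≤b)

  power : Carrier → ℕ → Carrier
  power a zero    = 𝟙
  power a (suc m) = a ⊗ power a m

  pow≡power : ∀ a m → pow L a m ≡ power a m
  pow≡power a zero          = refl
  pow≡power a (suc zero)    = sym (identityʳ a)
  pow≡power a (suc (suc m)) = cong (a ⊗_) (pow≡power a (suc m))

  ∨¬-shifts-power : ∀ x a t → x ∨ ¬ a ≤ (a ⊗ t) ⇒ (a ⊗ (x ⊗ t))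
  ∨¬-shifts-power x a t = ∨-least
    (residuation₁ _ _ _ (≤-reflexive (begin-equality
      x ⊗ (a ⊗ t) ≡⟨ assoc x a t ⟨
      (x ⊗ a) ⊗ t ≡⟨ cong (_⊗ t) (comm x a) ⟩
      (a ⊗ x) ⊗ t ≡⟨ assoc a x t ⟩
      a ⊗ (x ⊗ t) ∎)))
    (residuation₁ _ _ _ (begin
      ¬ a ⊗ (a ⊗ t) ≡⟨ assoc _ a t ⟨
      (¬ a ⊗ a) ⊗ t ≤⟨ ⊗-monoˡ-≤ t (⇒-eval a 𝟘) ⟩
      𝟘 ⊗ t         ≤⟨ 𝟘-zeroˡ t ⟩
      𝟘             ≤⟨ minimum _ ⟩
      a ⊗ (x ⊗ t)   ∎))

  ⇒-contraction : ∀ a y z → a ⇒ (y ⇒ z) ≤ (a ⇒ y) ⇒ (a ⊗ a ⇒ z)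
  ⇒-contraction a y z = residuation₁ _ _ _ (residuation₁ _ _ _ (begin
    (A ⊗ B) ⊗ (a ⊗ a) ≡⟨ assoc A B (a ⊗ a) ⟩
    A ⊗ (B ⊗ (a ⊗ a)) ≡⟨ cong (A ⊗_) (assoc B a a) ⟨
    A ⊗ ((B ⊗ a) ⊗ a) ≡⟨ cong (A ⊗_) (comm (B ⊗ a) a) ⟩
    A ⊗ (a ⊗ (B ⊗ a)) ≡⟨ assoc A a (B ⊗ a) ⟨
    (A ⊗ a) ⊗ (B ⊗ a) ≤⟨ ⊗-mono-≤ (⇒-eval a (y ⇒ z)) (⇒-eval a y) ⟩
    (y ⇒ z) ⊗ y       ≤⟨ ⇒-eval y z ⟩
    z                 ∎))
    where
    A = a ⇒ (y ⇒ z)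
    B = a ⇒ y

  ⇒-trans : ∀ a b d → (a ⇒ b) ⊗ (b ⇒ d) ≤ a ⇒ d
  ⇒-trans a b d = residuation₁ _ _ _ (begin
    ((a ⇒ b) ⊗ (b ⇒ d)) ⊗ a ≡⟨ cong (_⊗ a) (comm (a ⇒ b) (b ⇒ d)) ⟩
    ((b ⇒ d) ⊗ (a ⇒ b)) ⊗ a ≡⟨ assoc (b ⇒ d) (a ⇒ b) a ⟩
    (b ⇒ d) ⊗ ((a ⇒ b) ⊗ a) ≤⟨ ⊗-monoʳ-≤ (b ⇒ d) (⇒-eval a b) ⟩
    (b ⇒ d) ⊗ b             ≤⟨ ⇒-eval b d ⟩
    d                       ∎)

record IsFilter {c ℓ : Level} (L : ResiduatedLattice c ℓ)
                (F : ResiduatedLattice.Carrier L → Set ℓ) : Set (c ⊔ ℓ) where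
  open ResiduatedLattice L
  field
    𝟙∈F      : F 𝟙
    ≤-closed : ∀ {a b} → a ≤ b → F a → F b
    mp       : ∀ {a b} → F a → F (a ⇒ b) → F b

module FilterProperties {c ℓ : Level} {L : ResiduatedLattice c ℓ}
                        {F : ResiduatedLattice.Carrier L → Set ℓ} (isFilter : IsFilter L F) where
  open ResiduatedLattice L
  open ResiduatedLatticeProperties L
  open IsFilter isFilter

  ≤⇒⇒-closed : ∀ {a b} → a ≤ b → F (a ⇒ b)
  ≤⇒⇒-closed a≤b = subst F (sym (≤⇒⇒≡𝟙 a≤b)) 𝟙∈F

  ⊗-closed : ∀ {a b} → F a → F b → F (a ⊗ b)
  ⊗-closed Fa Fb = mp Fb (mp Fa (≤⇒⇒-closed (residuation₁ _ _ _ ≤-refl)))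

  ⇒-trans-closed : ∀ {a b d} → F (a ⇒ b) → F (b ⇒ d) → F (a ⇒ d)
  ⇒-trans-closed Fab Fbd = ≤-closed (⇒-trans _ _ _) (⊗-closed Fab Fbd)

  contraction-closed : ∀ {a y z} → F (a ⇒ a ⊗ a) → F (a ⇒ (y ⇒ z)) → F (a ⇒ y) → F (a ⇒ z)
  contraction-closed {a} {y} {z} Fa⇒a⊗a Fa⇒y⇒z Fa⇒y =
    ⇒-trans-closed Fa⇒a⊗a (mp Fa⇒y (≤-closed (⇒-contraction a y z) Fa⇒y⇒z))

  ∨¬-power-closed : ∀ {x a} → F (x ∨ ¬ a) → ∀ k → F (a ⇒ a ⊗ power x k)
  ∨¬-power-closed {x} {a} Fu zero    = ≤⇒⇒-closed (≤-reflexive (sym (identityʳ a)))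
  ∨¬-power-closed {x} {a} Fu (suc k) =
    ⇒-trans-closed (∨¬-power-closed Fu k) (≤-closed (∨¬-shifts-power x a (power x k)) Fu)

module PosImplFilterProperties {c ℓ : Level} (L : ResiduatedLattice c ℓ) (n : ℕ)
                               {F : ResiduatedLattice.Carrier L → Set ℓ}
                               (isPosImpl : IsNFoldPosImplFilter L n F) where
  open ResiduatedLattice L
  open ResiduatedLatticeProperties L

  private
    𝟙∈F = proj₁ isPosImpl
    posImpl = proj₂ isPosImpl

  isFilter : IsFilter L F
  isFilter = record { 𝟙∈F = 𝟙∈F ; ≤-closed = ≤-closed ; mp = mp }
    where
    ≤-closed : ∀ {a b} → a ≤ b → F a → F b
    ≤-closed {a} {b} a≤b Fa = posImpl a b 𝟙
      (subst F (sym (≤⇒⇒≡𝟙 (residuation₁ _ _ _ (≤-trans (x⊗y≤x a _) a≤b)))) 𝟙∈F) Fa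

    mp : ∀ {a b} → F a → F (a ⇒ b) → F b
    mp {a} {b} Fa Fa⇒b = posImpl (a ⇒ b) b 𝟙
      (≤-closed (residuation₁ _ _ _ (residuation₁ _ _ _
        (≤-trans (x⊗y≤x _ _) (subst (_≤ b) (comm (a ⇒ b) a) (⇒-eval a b))))) Fa) Fa⇒b

  open FilterProperties isFilter using (≤⇒⇒-closed)

  ∨¬pow-closed : ∀ x → F (x ∨ ¬ pow L x n)
  ∨¬pow-closed x = posImpl 𝟙 u 𝟘
    (subst (λ b → F (𝟙 ⇒ b)) (sym (≤⇒⇒≡𝟙 ¬uⁿ≤u)) (≤⇒⇒-closed ≤-refl)) 𝟙∈F
    where
    u = x ∨ ¬ pow L x n
    ¬uⁿ≤u : ¬ pow L u n ≤ u
    ¬uⁿ≤u = ≤-trans (¬-antitone (pow-mono-≤ n (x≤x∨y x _))) (y≤x∨y x _)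

theorem5p7 : {c ℓ : Level} (L : ResiduatedLattice c ℓ) (n : ℕ) → n ≥ 1 →
    (F : ResiduatedLattice.Carrier L → Set ℓ) →
    IsNFoldPosImplFilter L n F → IsNFoldImplFilter L n F
theorem5p7 L n _ F isPosImpl = IsFilter.𝟙∈F isFilter , λ x y z →
  contraction-closed (subst (λ b → F (pow L x n ⇒ pow L x n ⊗ b)) (sym (pow≡power x n))
                       (∨¬-power-closed (∨¬pow-closed x) n))
  where
  open PosImplFilterProperties L n isPosImpl
  open FilterProperties isFilter
  open ResiduatedLatticeProperties L using (pow≡power)
  open ResiduatedLattice L using (_⇒_; _⊗_)
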